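{- There is no Turing machine that, upon input of the code of an arbitrary computable binary-valued function class $\mathcal{G}\subseteq\{0,1\}^{\mathbb{N}}$, decides whether $\mathcal{G}$ has an infinite Littlestone tree. That is, the existence of infinite Littlestone trees is Turing undecidable.
   Context: $\mathbb{N}=\{0,1,2,\dots\}$. A class $\mathcal{G}\subseteq\mathbb{N}^{\mathbb{N}}$ is computable if there is a total computable $G:\mathbb{N}\times\mathbb{N}\to\mathbb{N}$ with $\mathcal{G}=\{n\mapsto G(m,n): m\in\mathbb{N}\}$; the code of the class is the code of $G$ with respect to a fixed universal Turing machine. A set of points $\{x_{\mathbf v}\}_{\mathbf v\in\{0,1\}^k, 0\le k<d}\subseteq\mathcal{X}$ indexed by nodes of a complete binary tree is a Littlestone tree of depth $d\le\infty$ of $\mathcal{G}\subseteq\{0,1\}^{\mathcal{X}}$ if for every $y_1,y_2,\dots\in\{0,1\}$ and every $0\le n<d$ there is $g\in\mathcal{G}$ with $g(x_{y_1\dots y_k})=y_{k+1}$ for all $0\le k\le n$; an infinite Littlestone tree is one of depth $\infty$. -}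

module Defs where

open import Data.Nat using (ℕ; zero; suc; _+_; _*_; _∸_; _^_; _≤_)
open import Data.Bool using (Bool; true; false)
open import Data.List using (List; []; _∷_; _++_)
open import Data.Maybe using (Maybe; just; nothing; _>>=_)
open import Data.Product using (Σ; _×_; ∃)
open import Relation.Binary.PropositionalEquality using (_≡_)
open import Relation.Nullary using (¬_)

-- A fixed model of computation: codes of partial recursive functions
-- (μ-recursive functions), with a fuel-indexed evaluator.
-- Arguments are passed as a list; missing arguments default to 0.

data Code : Set where
  zer  : Code
  succ : Code
  proj : ℕ → Code
  comp : Code → List Code → Code
  prim : Code → Code → Code
  mu   : Code → Code

head0 : List ℕ → ℕ
head0 []      = 0
head0 (x ∷ _) = x

nth0 : ℕ → List ℕ → ℕ
nth0 _       []       = 0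
nth0 zero    (x ∷ _)  = x
nth0 (suc i) (_ ∷ xs) = nth0 i xs

tail0 : List ℕ → List ℕ
tail0 []       = []
tail0 (_ ∷ xs) = xs

mutual
  eval : ℕ → Code → List ℕ → Maybe ℕ
  eval zero    _           _  = nothing
  eval (suc k) zer         _  = just 0
  eval (suc k) succ        xs = just (suc (head0 xs))
  eval (suc k) (proj i)    xs = just (nth0 i xs)
  eval (suc k) (comp f gs) xs = evalList k gs xs >>= λ ys → eval k f ys
  eval (suc k) (prim f g)  xs = primRec k f g (head0 xs) (tail0 xs)
  eval (suc k) (mu f)      xs = muSearch k f xs 0

  evalList : ℕ → List Code → List ℕ → Maybe (List ℕ)
  evalList k []       xs = just []
  evalList k (g ∷ gs) xs =
    eval k g xs >>= λ y → evalList k gs xs >>= λ ys → just (y ∷ ys)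

  primRec : ℕ → Code → Code → ℕ → List ℕ → Maybe ℕ
  primRec k f g zero    xs = eval k f xs
  primRec zero    f g (suc n) xs = nothing
  primRec (suc k) f g (suc n) xs =
    primRec k f g n xs >>= λ r → eval k g (n ∷ r ∷ xs)

  muSearch : ℕ → Code → List ℕ → ℕ → Maybe ℕ
  muSearch zero    f xs i = nothing
  muSearch (suc k) f xs i with eval k f (i ∷ xs)
  ... | nothing      = nothing
  ... | just zero    = just i
  ... | just (suc _) = muSearch k f xs (suc i)

Halts : Code → List ℕ → ℕ → Set
Halts c xs v = ∃ λ fuel → eval fuel c xs ≡ just v

-- Injective Gödel numbering of codes (the "code" fed to a machine).

pair : ℕ → ℕ → ℕ
pair a b = 2 ^ a * (2 * b + 1) ∸ 1

mutual
  ⌜_⌝ : Code → ℕ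
  ⌜ zer ⌝       = pair 0 0
  ⌜ succ ⌝      = pair 1 0
  ⌜ proj i ⌝    = pair 2 i
  ⌜ comp f gs ⌝ = pair 3 (pair ⌜ f ⌝ ⌜ gs ⌝L)
  ⌜ prim f g ⌝  = pair 4 (pair ⌜ f ⌝ ⌜ g ⌝)
  ⌜ mu f ⌝      = pair 5 ⌜ f ⌝

  ⌜_⌝L : List Code → ℕ
  ⌜ [] ⌝L     = 0
  ⌜ g ∷ gs ⌝L = suc (pair ⌜ g ⌝ ⌜ gs ⌝L)

bit : Bool → ℕ
bit false = 0
bit true  = 1

Computes₂ : Code → (ℕ → ℕ → ℕ) → Set
Computes₂ c G = ∀ m n → Halts c (m ∷ n ∷ []) (G m n)

-- Littlestone trees.  A binary-valued class {n ↦ G m n : m ∈ ℕ} ⊆ {0,1}^ℕ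
-- is given by G : ℕ → ℕ → Bool.  Tree nodes are finite bit strings.

prefix : (ℕ → Bool) → ℕ → List Bool
prefix y zero    = []
prefix y (suc k) = prefix y k ++ (y k ∷ [])

-- x is a Littlestone tree of infinite depth of the class given by G:
-- for every branch y₁ y₂ … and every n there is g in the class with
-- g (x_{y₁…y_k}) = y_{k+1} for all 0 ≤ k ≤ n.  (Here y is 0-indexed.)
IsInfiniteLittlestoneTree : (ℕ → ℕ → Bool) → (List Bool → ℕ) → Set
IsInfiniteLittlestoneTree G x =
  ∀ (y : ℕ → Bool) (n : ℕ) →
    Σ ℕ λ m → ∀ k → k ≤ n → G m (x (prefix y k)) ≡ y k

HasInfiniteLittlestoneTree : (ℕ → ℕ → Bool) → Set
HasInfiniteLittlestoneTree G = Σ (List Bool → ℕ) (IsInfiniteLittlestoneTree G)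

DecidesInfiniteLittlestone : Code → Set
DecidesInfiniteLittlestone D =
  ∀ (c : Code) (G : ℕ → ℕ → Bool) → Computes₂ c (λ m n → bit (G m n)) →
    (HasInfiniteLittlestoneTree G → Halts D (⌜ c ⌝ ∷ []) 1) ×
    (¬ HasInfiniteLittlestoneTree G → Halts D (⌜ c ⌝ ∷ []) 0)

-- A decider D is defeated by a class that consults D about its own code.  The class
-- {g_m} lets g_m(n) be the n-th binary digit of m as soon as D, run on the code of this
-- very class, has answered 0 within n steps, and 0 before; the self-reference is an
-- explicit quine (selfApply), and totality comes from evaluating D with fuel n through a
-- primitive recursive clocked interpreter.  If D answers 1 ("no infinite tree"), every
-- g_m is identically 0, so not even the root of a Littlestone tree can be labelled 1.
-- If D answers 0 after t steps, the binary digits of the m realise every labelling of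
-- t, t + 1, …, so x_v = t + |v| is an infinite Littlestone tree.  Either way D errs.

module Submission where

open import Defs
open import Data.Bool using (Bool; true; false)
open import Data.Empty using (⊥-elim)
open import Data.List using (List; []; _∷_; _++_; length; map)
open import Data.List.Properties using (length-++; length-map)
open import Data.List.Relation.Binary.Pointwise using (Pointwise; []; _∷_; map⁺)
import Data.List.Relation.Binary.Pointwise as Pointwise
open import Data.Maybe using (Maybe; just; nothing; _>>=_)
open import Data.Maybe.Properties using (just-injective)
open import Data.Nat using (ℕ; zero; suc; _+_; _*_; _∸_; _^_; _≤_; _<_; z≤n; s≤s; pred; _≤?_)
open import Data.Nat.Properties
open import Data.Product using (Σ; _×_; _,_; ∃; proj₁; proj₂)
open import Relation.Nullary using (¬_; yes; no)
open import Relation.Binary.PropositionalEquality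

-- Evaluation is monotone and deterministic in the fuel

bind≡just⁻ : ∀ {A B : Set} (m : Maybe A) (f : A → Maybe B) {v} →
             (m >>= f) ≡ just v → ∃ λ a → m ≡ just a × f a ≡ just v
bind≡just⁻ (just a) f e = a , refl , e

bind≡just⁺ : ∀ {A B : Set} {m : Maybe A} {a} (f : A → Maybe B) {v} →
             m ≡ just a → f a ≡ just v → (m >>= f) ≡ just v
bind≡just⁺ f refl e = e

muStep : Maybe ℕ → ℕ → Maybe ℕ → Maybe ℕ
muStep nothing        i r = nothing
muStep (just zero)    i r = just i
muStep (just (suc _)) i r = r

muSearch-unfold : ∀ k f xs i →
  muSearch (suc k) f xs i ≡ muStep (eval k f (i ∷ xs)) i (muSearch k f xs (suc i))
muSearch-unfold k f xs i with eval k f (i ∷ xs)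
... | nothing      = refl
... | just zero    = refl
... | just (suc _) = refl

mutual
  eval-mono : ∀ k c xs v → eval k c xs ≡ just v → eval (suc k) c xs ≡ just v
  eval-mono (suc k) zer         xs v e = e
  eval-mono (suc k) succ        xs v e = e
  eval-mono (suc k) (proj i)    xs v e = e
  eval-mono (suc k) (comp f gs) xs v e with bind≡just⁻ (evalList k gs xs) _ e
  ... | ys , e₁ , e₂ = bind≡just⁺ _ (evalList-mono k gs xs ys e₁) (eval-mono k f ys v e₂)
  eval-mono (suc k) (prim f g)  xs v e = primRec-mono k f g (head0 xs) (tail0 xs) v e
  eval-mono (suc k) (mu f)      xs v e = muSearch-mono k f xs 0 v e

  evalList-mono : ∀ k gs xs ys → evalList k gs xs ≡ just ys → evalList (suc k) gs xs ≡ just ys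
  evalList-mono k []       xs ys e = e
  evalList-mono k (g ∷ gs) xs ys e with bind≡just⁻ (eval k g xs) _ e
  ... | y , e₁ , e₂ with bind≡just⁻ (evalList k gs xs) _ e₂
  ... | zs , e₃ , e₄ =
    bind≡just⁺ _ (eval-mono k g xs y e₁) (bind≡just⁺ _ (evalList-mono k gs xs zs e₃) e₄)

  primRec-mono : ∀ k f g n xs v → primRec k f g n xs ≡ just v → primRec (suc k) f g n xs ≡ just v
  primRec-mono k       f g zero    xs v e = eval-mono k f xs v e
  primRec-mono (suc k) f g (suc n) xs v e with bind≡just⁻ (primRec k f g n xs) _ e
  ... | r , e₁ , e₂ = bind≡just⁺ _ (primRec-mono k f g n xs r e₁) (eval-mono k g (n ∷ r ∷ xs) v e₂)

  muSearch-mono : ∀ k f xs i v → muSearch k f xs i ≡ just v → muSearch (suc k) f xs i ≡ just v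
  muSearch-mono (suc k) f xs i v e
    rewrite muSearch-unfold k f xs i | muSearch-unfold (suc k) f xs i =
      step (eval k f (i ∷ xs)) refl e
    where
    step : ∀ m → eval k f (i ∷ xs) ≡ m → muStep m i (muSearch k f xs (suc i)) ≡ just v →
           muStep (eval (suc k) f (i ∷ xs)) i (muSearch (suc k) f xs (suc i)) ≡ just v
    step (just zero)    e₁ e₂ rewrite eval-mono k f (i ∷ xs) zero e₁    = e₂
    step (just (suc w)) e₁ e₂ rewrite eval-mono k f (i ∷ xs) (suc w) e₁ = muSearch-mono k f xs (suc i) v e₂

fuel-mono : ∀ {P : ℕ → Set} → (∀ {k} → P k → P (suc k)) → ∀ {k k′} → k ≤ k′ → P k → P k′
fuel-mono {P} step {k} {k′} k≤k′ p = subst P (m∸n+n≡m k≤k′) (more (k′ ∸ k))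
  where
  more : ∀ d → P (d + k)
  more zero    = p
  more (suc d) = step (more d)

eval-≤ : ∀ c xs {k k′ v} → k ≤ k′ → eval k c xs ≡ just v → eval k′ c xs ≡ just v
eval-≤ c xs {v = v} = fuel-mono (λ {k} → eval-mono k c xs v)

evalList-≤ : ∀ gs xs {k k′ ys} → k ≤ k′ → evalList k gs xs ≡ just ys → evalList k′ gs xs ≡ just ys
evalList-≤ gs xs {ys = ys} = fuel-mono (λ {k} → evalList-mono k gs xs ys)

primRec-≤ : ∀ f g n xs {k k′ v} → k ≤ k′ → primRec k f g n xs ≡ just v → primRec k′ f g n xs ≡ just v
primRec-≤ f g n xs {v = v} = fuel-mono (λ {k} → primRec-mono k f g n xs v)

eval-deterministic : ∀ {a b c xs u v} → eval a c xs ≡ just u → eval b c xs ≡ just v → u ≡ v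
eval-deterministic {a} {b} {c} {xs} e₁ e₂ =
  just-injective (trans (sym (eval-≤ c xs (m≤m+n a b) e₁)) (eval-≤ c xs (m≤n+m b a) e₂))

-- A record rather than Halts, so that c, xs and v can be inferred from the type.
infix 4 _·_⇓_ _·_⇓*_
record _·_⇓_ (c : Code) (xs : List ℕ) (v : ℕ) : Set where
  constructor halts
  field
    fuel      : ℕ
    converges : eval fuel c xs ≡ just v

_·_⇓*_ : List Code → List ℕ → List ℕ → Set
gs · xs ⇓* ys = Pointwise (λ g y → g · xs ⇓ y) gs ys

⇓⇒Halts : ∀ {c xs v} → c · xs ⇓ v → Halts c xs v
⇓⇒Halts (halts k e) = k , e

⇓-≡ : ∀ {c xs v w} → v ≡ w → c · xs ⇓ v → c · xs ⇓ w
⇓-≡ refl h = h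

⇓-zer : ∀ {xs} → zer · xs ⇓ 0
⇓-zer = halts 1 refl

⇓-succ : ∀ {x xs} → succ · x ∷ xs ⇓ suc x
⇓-succ = halts 1 refl

⇓-proj : ∀ i {xs} → proj i · xs ⇓ nth0 i xs
⇓-proj i = halts 1 refl

evalList-⇓* : ∀ {gs xs ys} → gs · xs ⇓* ys → ∃ λ k → evalList k gs xs ≡ just ys
evalList-⇓* []                 = 0 , refl
evalList-⇓* {g ∷ gs} {xs} (halts a e ∷ rest) with evalList-⇓* rest
... | k , e′ = a + k , bind≡just⁺ _ (eval-≤ g xs (m≤m+n a k) e)
                         (bind≡just⁺ _ (evalList-≤ gs xs (m≤n+m k a) e′) refl)

⇓-comp : ∀ {f gs xs ys v} → f · ys ⇓ v → gs · xs ⇓* ys → comp f gs · xs ⇓ v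
⇓-comp {f} {gs} {xs} {ys} (halts a e) hs with evalList-⇓* hs
... | b , e′ = halts (suc (a + b))
                 (bind≡just⁺ _ (evalList-≤ gs xs (m≤n+m b a) e′) (eval-≤ f ys (m≤m+n a b) e))

⇓-prim : ∀ {F G xs} (f : ℕ → ℕ) → F · xs ⇓ f 0 → (∀ j → G · j ∷ f j ∷ xs ⇓ f (suc j)) →
         ∀ n → prim F G · n ∷ xs ⇓ f n
⇓-prim {F} {G} {xs} f (halts a e) step n = let k , e′ = primRec-⇓ n in halts (suc k) e′
  where
  primRec-⇓ : ∀ n → ∃ λ k → primRec k F G n xs ≡ just (f n)
  primRec-⇓ zero = a , e
  primRec-⇓ (suc n) with primRec-⇓ n | step n
  ... | k , e₁ | halts b e₂ =
    suc (k + b) , bind≡just⁺ _ (primRec-≤ F G n xs (m≤m+n k b) e₁) (eval-≤ G _ (m≤n+m b k) e₂)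

comp₁ : Code → Code → Code
comp₁ F a = comp F (a ∷ [])

comp₂ : Code → Code → Code → Code
comp₂ F a b = comp F (a ∷ b ∷ [])

comp₃ : Code → Code → Code → Code → Code
comp₃ F a b c = comp F (a ∷ b ∷ c ∷ [])

⇓-comp₁ : ∀ {F a xs u w} → F · u ∷ [] ⇓ w → a · xs ⇓ u → comp₁ F a · xs ⇓ w
⇓-comp₁ hF ha = ⇓-comp hF (ha ∷ [])

⇓-comp₂ : ∀ {F a b xs u v w} → F · u ∷ v ∷ [] ⇓ w → a · xs ⇓ u → b · xs ⇓ v → comp₂ F a b · xs ⇓ w
⇓-comp₂ hF ha hb = ⇓-comp hF (ha ∷ hb ∷ [])

⇓-comp₃ : ∀ {F a b c xs u v s w} → F · u ∷ v ∷ s ∷ [] ⇓ w →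
          a · xs ⇓ u → b · xs ⇓ v → c · xs ⇓ s → comp₃ F a b c · xs ⇓ w
⇓-comp₃ hF ha hb hc = ⇓-comp hF (ha ∷ hb ∷ hc ∷ [])

K : ℕ → Code
K zero    = zer
K (suc n) = comp₁ succ (K n)

⇓-K : ∀ n {xs} → K n · xs ⇓ n
⇓-K zero    = ⇓-zer
⇓-K (suc n) = ⇓-comp₁ ⇓-succ (⇓-K n)

cond : ℕ → ℕ → ℕ
cond zero    b = 0
cond (suc _) b = b

ifZero : ℕ → ℕ → ℕ → ℕ
ifZero zero    a b = a
ifZero (suc _) a b = b

isZero : ℕ → ℕ
isZero zero    = 1
isZero (suc _) = 0

isOne : ℕ → ℕ
isOne zero    = 0
isOne (suc n) = isZero n

COND : Code
COND = prim zer (proj 2)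

⇓-COND : ∀ a b → COND · a ∷ b ∷ [] ⇓ cond a b
⇓-COND a b = ⇓-prim (λ a → cond a b) ⇓-zer (λ _ → ⇓-proj 2) a

IFZERO : Code
IFZERO = prim (proj 0) (proj 3)

⇓-IFZERO : ∀ n a b → IFZERO · n ∷ a ∷ b ∷ [] ⇓ ifZero n a b
⇓-IFZERO n a b = ⇓-prim (λ n → ifZero n a b) (⇓-proj 0) (λ _ → ⇓-proj 3) n

ISZERO : Code
ISZERO = prim (K 1) zer

⇓-ISZERO : ∀ a → ISZERO · a ∷ [] ⇓ isZero a
⇓-ISZERO = ⇓-prim isZero (⇓-K 1) (λ _ → ⇓-zer)

ISONE : Code
ISONE = prim zer (comp₁ ISZERO (proj 0))

⇓-ISONE : ∀ a → ISONE · a ∷ [] ⇓ isOne a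
⇓-ISONE = ⇓-prim isOne ⇓-zer (λ j → ⇓-comp₁ (⇓-ISZERO j) (⇓-proj 0))

PRED : Code
PRED = prim zer (proj 0)

⇓-PRED : ∀ a → PRED · a ∷ [] ⇓ pred a
⇓-PRED = ⇓-prim pred ⇓-zer (λ _ → ⇓-proj 0)

ADD : Code
ADD = prim (proj 0) (comp₁ succ (proj 1))

⇓-ADD : ∀ a b → ADD · a ∷ b ∷ [] ⇓ a + b
⇓-ADD a b = ⇓-prim (_+ b) (⇓-proj 0) (λ _ → ⇓-comp₁ ⇓-succ (⇓-proj 1)) a

MUL : Code
MUL = prim zer (comp₂ ADD (proj 1) (proj 2))

⇓-MUL : ∀ a b → MUL · a ∷ b ∷ [] ⇓ a * b
⇓-MUL a b = ⇓-prim (_* b) ⇓-zer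
  (λ j → ⇓-≡ (+-comm (j * b) b) (⇓-comp₂ (⇓-ADD _ _) (⇓-proj 1) (⇓-proj 2))) a

MONUS : Code
MONUS = prim (proj 0) (comp₁ PRED (proj 1))

SUB : Code
SUB = comp₂ MONUS (proj 1) (proj 0)

⇓-SUB : ∀ a b → SUB · a ∷ b ∷ [] ⇓ a ∸ b
⇓-SUB a b = ⇓-comp₂ monus (⇓-proj 1) (⇓-proj 0)
  where
  monus : MONUS · b ∷ a ∷ [] ⇓ a ∸ b
  monus = ⇓-prim (a ∸_) (⇓-proj 0)
    (λ j → ⇓-≡ (pred[m∸n]≡m∸[1+n] a j) (⇓-comp₁ (⇓-PRED _) (⇓-proj 1))) b

POW2 : Code
POW2 = prim (K 1) (comp₂ MUL (proj 1) (K 2))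

⇓-POW2 : ∀ a → POW2 · a ∷ [] ⇓ 2 ^ a
⇓-POW2 = ⇓-prim (2 ^_) (⇓-K 1)
  (λ j → ⇓-≡ (*-comm (2 ^ j) 2) (⇓-comp₂ (⇓-MUL _ _) (⇓-proj 1) (⇓-K 2)))

parity : ℕ → ℕ
parity zero    = 0
parity (suc n) = isZero (parity n)

half : ℕ → ℕ
half zero    = 0
half (suc n) = half n + parity n

shiftR : ℕ → ℕ → ℕ
shiftR zero    m = m
shiftR (suc n) m = half (shiftR n m)

testBit : ℕ → ℕ → ℕ
testBit n m = parity (shiftR n m)

fromBits : (ℕ → Bool) → ℕ → ℕ
fromBits y zero    = 0
fromBits y (suc L) = bit (y 0) + 2 * fromBits (λ i → y (suc i)) L

isZero≤1 : ∀ a → isZero a ≤ 1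
isZero≤1 zero    = s≤s z≤n
isZero≤1 (suc a) = z≤n

parity≤1 : ∀ a → parity a ≤ 1
parity≤1 zero    = z≤n
parity≤1 (suc a) = isZero≤1 (parity a)

parity-suc-suc : ∀ n → parity (suc (suc n)) ≡ parity n
parity-suc-suc n with parity n | parity≤1 n
... | zero     | _ = refl
... | suc zero | _ = refl
... | suc (suc _) | s≤s ()

half-suc-suc : ∀ n → half (suc (suc n)) ≡ suc (half n)
half-suc-suc n with parity n | parity≤1 n
... | zero     | _ = trans (cong (_+ 1) (+-identityʳ (half n))) (+-comm (half n) 1)
... | suc zero | _ = trans (+-identityʳ (half n + 1)) (+-comm (half n) 1)
... | suc (suc _) | s≤s ()

bit+2*suc : ∀ b a → bit b + 2 * suc a ≡ suc (suc (bit b + 2 * a))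
bit+2*suc b a = begin
  bit b + 2 * suc a             ≡⟨ cong (bit b +_) (*-suc 2 a) ⟩
  bit b + (2 + 2 * a)           ≡⟨ +-suc (bit b) (suc (2 * a)) ⟩
  suc (bit b + suc (2 * a))     ≡⟨ cong suc (+-suc (bit b) (2 * a)) ⟩
  suc (suc (bit b + 2 * a))     ∎
  where open ≡-Reasoning

half-bit+2* : ∀ b a → half (bit b + 2 * a) ≡ a
half-bit+2* false zero    = refl
half-bit+2* true  zero    = refl
half-bit+2* b     (suc a) rewrite bit+2*suc b a =
  trans (half-suc-suc (bit b + 2 * a)) (cong suc (half-bit+2* b a))

parity-bit+2* : ∀ b a → parity (bit b + 2 * a) ≡ bit b
parity-bit+2* false zero    = refl
parity-bit+2* true  zero    = refl
parity-bit+2* b     (suc a) rewrite bit+2*suc b a =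
  trans (parity-suc-suc (bit b + 2 * a)) (parity-bit+2* b a)

shiftR-half : ∀ i m → shiftR i (half m) ≡ half (shiftR i m)
shiftR-half zero    m = refl
shiftR-half (suc i) m = cong half (shiftR-half i m)

testBit-fromBits : ∀ y L i → i < L → testBit i (fromBits y L) ≡ bit (y i)
testBit-fromBits y (suc L) zero    _         = parity-bit+2* (y 0) (fromBits (λ i → y (suc i)) L)
testBit-fromBits y (suc L) (suc i) (s≤s i<L) = begin
  parity (half (shiftR i m))  ≡⟨ cong parity (shiftR-half i m) ⟨
  parity (shiftR i (half m))  ≡⟨ cong (testBit i) (half-bit+2* (y 0) m′) ⟩
  testBit i m′                ≡⟨ testBit-fromBits (λ j → y (suc j)) L i i<L ⟩
  bit (y (suc i))             ∎
  where
  open ≡-Reasoning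
  m′ = fromBits (λ j → y (suc j)) L
  m  = bit (y 0) + 2 * m′

PARITY : Code
PARITY = prim zer (comp₁ ISZERO (proj 1))

⇓-PARITY : ∀ a → PARITY · a ∷ [] ⇓ parity a
⇓-PARITY = ⇓-prim parity ⇓-zer (λ j → ⇓-comp₁ (⇓-ISZERO _) (⇓-proj 1))

HALF : Code
HALF = prim zer (comp₂ ADD (proj 1) (comp₁ PARITY (proj 0)))

⇓-HALF : ∀ a → HALF · a ∷ [] ⇓ half a
⇓-HALF = ⇓-prim half ⇓-zer (λ j → ⇓-comp₂ (⇓-ADD _ _) (⇓-proj 1) (⇓-comp₁ (⇓-PARITY j) (⇓-proj 0)))

TESTBIT : Code
TESTBIT = comp₁ PARITY (prim (proj 0) (comp₁ HALF (proj 1)))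

⇓-TESTBIT : ∀ n m → TESTBIT · n ∷ m ∷ [] ⇓ testBit n m
⇓-TESTBIT n m = ⇓-comp₁ (⇓-PARITY _)
  (⇓-prim (λ n → shiftR n m) (⇓-proj 0) (λ _ → ⇓-comp₁ (⇓-HALF _) (⇓-proj 1)) n)

PAIR : Code
PAIR = comp₂ SUB (comp₂ MUL (comp₁ POW2 (proj 0)) (comp₁ succ (comp₂ MUL (K 2) (proj 1)))) (K 1)

⇓-pair : ∀ {a b xs u v} → a · xs ⇓ u → b · xs ⇓ v → comp₂ PAIR a b · xs ⇓ pair u v
⇓-pair {u = u} {v} ha hb = ⇓-comp₂ pairing ha hb
  where
  pairing : PAIR · u ∷ v ∷ [] ⇓ pair u v
  pairing = ⇓-≡ (cong (λ z → 2 ^ u * z ∸ 1) (+-comm 1 (2 * v)))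
    (⇓-comp₂ (⇓-SUB _ _)
      (⇓-comp₂ (⇓-MUL _ _) (⇓-comp₁ (⇓-POW2 u) (⇓-proj 0))
                          (⇓-comp₁ ⇓-succ (⇓-comp₂ (⇓-MUL 2 v) (⇓-K 2) (⇓-proj 1))))
      (⇓-K 1))

NUMERAL : Code
NUMERAL = prim (comp₂ PAIR (K 0) (K 0))
  (comp₂ PAIR (K 3) (comp₂ PAIR (comp₂ PAIR (K 1) (K 0)) (comp₁ succ (comp₂ PAIR (proj 1) (K 0)))))

⇓-NUMERAL : ∀ b → NUMERAL · b ∷ [] ⇓ ⌜ K b ⌝
⇓-NUMERAL = ⇓-prim (λ b → ⌜ K b ⌝) (⇓-pair (⇓-K 0) (⇓-K 0))
  (λ _ → ⇓-pair (⇓-K 3) (⇓-pair (⇓-pair (⇓-K 1) (⇓-K 0)) (⇓-comp₁ ⇓-succ (⇓-pair (⇓-proj 1) (⇓-K 0)))))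

-- A quine construction: the Gödel number of selfApply X is computed from ⌜ X ⌝ alone,
-- selfApplyCode ⌜ X ⌝ being definitionally ⌜ selfApply X ⌝.
selfApply : Code → Code
selfApply X = comp X (K ⌜ X ⌝ ∷ proj 0 ∷ proj 1 ∷ [])

selfApplyCode : ℕ → ℕ
selfApplyCode b = pair 3 (pair b ⌜ K b ∷ proj 0 ∷ proj 1 ∷ [] ⌝L)

SELFAPPLY : Code
SELFAPPLY = comp₂ PAIR (K 3) (comp₂ PAIR (proj 0) (comp₁ succ
  (comp₂ PAIR (comp₁ NUMERAL (proj 0)) (comp₁ succ
    (comp₂ PAIR (comp₂ PAIR (K 2) (K 0)) (comp₁ succ
      (comp₂ PAIR (comp₂ PAIR (K 2) (K 1)) (K 0))))))))

⇓-SELFAPPLY : ∀ b → SELFAPPLY · b ∷ [] ⇓ selfApplyCode b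
⇓-SELFAPPLY b = ⇓-pair (⇓-K 3) (⇓-pair (⇓-proj 0) (⇓-comp₁ ⇓-succ
  (⇓-pair (⇓-comp₁ (⇓-NUMERAL b) (⇓-proj 0)) (⇓-comp₁ ⇓-succ
    (⇓-pair (⇓-pair (⇓-K 2) (⇓-K 0)) (⇓-comp₁ ⇓-succ
      (⇓-pair (⇓-pair (⇓-K 2) (⇓-K 1)) (⇓-K 0))))))))

-- A clocked interpreter

enc : Maybe ℕ → ℕ
enc nothing  = 0
enc (just v) = suc v

projs : ℕ → ℕ → List Code
projs s zero    = []
projs s (suc N) = proj s ∷ projs (suc s) N

slice : ℕ → ℕ → List ℕ → List ℕ
slice s zero    L = []
slice s (suc N) L = nth0 s L ∷ slice (suc s) N L

⇓-projs : ∀ s N L → projs s N · L ⇓* slice s N L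
⇓-projs s zero    L = []
⇓-projs s (suc N) L = ⇓-proj s ∷ ⇓-projs (suc s) N L

slice-∷ : ∀ s N x L → slice (suc s) N (x ∷ L) ≡ slice s N L
slice-∷ s zero    x L = refl
slice-∷ s (suc N) x L = cong (nth0 s L ∷_) (slice-∷ (suc s) N x L)

slice-all : ∀ xs → slice 0 (length xs) xs ≡ xs
slice-all []       = refl
slice-all (x ∷ xs) = cong (x ∷_) (trans (slice-∷ 0 (length xs) x xs) (slice-all xs))

slice-drop : ∀ zs xs → slice (length zs) (length xs) (zs ++ xs) ≡ xs
slice-drop []       xs = slice-all xs
slice-drop (z ∷ zs) xs = trans (slice-∷ (length zs) (length xs) z (zs ++ xs)) (slice-drop zs xs)

⇓-drop : ∀ zs {xs N} → length xs ≡ N → projs (length zs) N · zs ++ xs ⇓* xs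
⇓-drop zs {xs} refl = subst (projs (length zs) (length xs) · zs ++ xs ⇓*_) (slice-drop zs xs) (⇓-projs _ _ _)

⇓-tail : ∀ t xs {N} → length xs ≡ N → projs 2 (pred N) · t ∷ xs ⇓* tail0 xs
⇓-tail t []       refl = []
⇓-tail t (x ∷ xs) refl = ⇓-drop (t ∷ x ∷ []) refl

length-tail0 : ∀ xs {N} → length xs ≡ N → length (tail0 xs) ≡ pred N
length-tail0 []       refl = refl
length-tail0 (x ∷ xs) refl = refl

nth0-zero : ∀ xs → nth0 0 xs ≡ head0 xs
nth0-zero []      = refl
nth0-zero (x ∷ _) = refl

condAll : List ℕ → ℕ → ℕ
condAll []       x = x
condAll (s ∷ ss) x = cond s (condAll ss x)

CONDALL : List Code → Code → Code
CONDALL []       x = x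
CONDALL (a ∷ as) x = comp₂ COND a (CONDALL as x)

⇓-CONDALL : ∀ {gs L ys x v} → gs · L ⇓* ys → x · L ⇓ v → CONDALL gs x · L ⇓ condAll ys v
⇓-CONDALL []       hx = hx
⇓-CONDALL (h ∷ hs) hx = ⇓-comp₂ (⇓-COND _ _) h (⇓-CONDALL hs hx)

muStepEnc : ℕ → ℕ → ℕ → ℕ
muStepEnc s i r = cond s (ifZero (pred s) (suc i) r)

MUSTEP : Code
MUSTEP = comp₂ COND (proj 0) (comp₃ IFZERO (comp₁ PRED (proj 0)) (comp₁ succ (proj 1)) (proj 2))

⇓-MUSTEP : ∀ s i r → MUSTEP · s ∷ i ∷ r ∷ [] ⇓ muStepEnc s i r
⇓-MUSTEP s i r = ⇓-comp₂ (⇓-COND _ _) (⇓-proj 0)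
  (⇓-comp₃ (⇓-IFZERO _ _ _) (⇓-comp₁ (⇓-PRED _) (⇓-proj 0)) (⇓-comp₁ ⇓-succ (⇓-proj 1)) (⇓-proj 2))

FUEL-1 : Code
FUEL-1 = comp₁ PRED (proj 0)

⇓-FUEL-1 : ∀ {t xs} → FUEL-1 · t ∷ xs ⇓ pred t
⇓-FUEL-1 = ⇓-comp₁ (⇓-PRED _) (⇓-proj 0)

-- clocked c N maps t ∷ xs, for xs of length N, to enc (eval t c xs).
mutual
  clocked : Code → ℕ → Code
  clocked zer         N = comp₂ COND (proj 0) (K 1)
  clocked succ        N = comp₂ COND (proj 0) (comp₁ succ (comp₁ succ (proj 1)))
  clocked (proj i)    N = comp₂ COND (proj 0) (comp₁ succ (proj (suc i)))
  clocked (comp f gs) N = comp₂ COND (proj 0)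
    (CONDALL (clockedL gs N) (comp (clocked f (length gs)) (FUEL-1 ∷ map (comp₁ PRED) (clockedL gs N))))
  clocked (prim f g)  N = comp₂ COND (proj 0)
    (comp₂ COND (comp₁ ISZERO (comp₂ SUB (proj 1) FUEL-1))
      (comp (prim (clocked f (pred N))
                  (comp₂ COND (proj 1) (comp (clocked g (suc (suc (pred N))))
                    (comp₂ ADD (proj 2) (proj 0) ∷ proj 0 ∷ comp₁ PRED (proj 1) ∷ projs 3 (pred N)))))
            (proj 1 ∷ comp₂ SUB FUEL-1 (proj 1) ∷ projs 2 (pred N))))
  clocked (mu f)      N = comp₂ COND (proj 0)
    (comp (prim zer (comp₃ MUSTEP (comp (clocked f (suc N)) (proj 0 ∷ position ∷ projs 3 N)) position (proj 1)))
          (FUEL-1 ∷ FUEL-1 ∷ projs 1 N))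
    where
    position = comp₂ SUB (proj 2) (comp₁ succ (proj 0))

  clockedL : List Code → ℕ → List Code
  clockedL []       N = []
  clockedL (g ∷ gs) N = comp (clocked g N) (FUEL-1 ∷ projs 1 N) ∷ clockedL gs N

enc-bind : ∀ (m : Maybe ℕ) (F : ℕ → Maybe ℕ) → enc (m >>= F) ≡ cond (enc m) (enc (F (pred (enc m))))
enc-bind nothing  F = refl
enc-bind (just r) F = refl

bind-assoc : ∀ {A B C : Set} (m : Maybe A) (g : A → Maybe B) (F : B → Maybe C) →
             ((m >>= g) >>= F) ≡ (m >>= λ x → g x >>= F)
bind-assoc nothing  g F = refl
bind-assoc (just x) g F = refl

encs : ℕ → List Code → List ℕ → List ℕ
encs k gs xs = map (λ g → enc (eval k g xs)) gs

enc-evalList-bind : ∀ k gs xs (F : List ℕ → Maybe ℕ) →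
  enc (evalList k gs xs >>= F) ≡ condAll (encs k gs xs) (enc (F (map pred (encs k gs xs))))
enc-evalList-bind k []       xs F = refl
enc-evalList-bind k (g ∷ gs) xs F = byHead (eval k g xs)
  where
  byHead : (m : Maybe ℕ) →
    enc ((m >>= λ y → evalList k gs xs >>= λ ys → just (y ∷ ys)) >>= F) ≡
    cond (enc m) (condAll (encs k gs xs) (enc (F (pred (enc m) ∷ map pred (encs k gs xs)))))
  byHead nothing  = refl
  byHead (just y) = trans (cong enc (bind-assoc (evalList k gs xs) (λ ys → just (y ∷ ys)) F))
                          (enc-evalList-bind k gs xs (λ ys → F (y ∷ ys)))

primRec-outOfFuel : ∀ k n f g ys → k < n → primRec k f g n ys ≡ nothing
primRec-outOfFuel zero    (suc n) f g ys _         = refl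
primRec-outOfFuel (suc k) (suc n) f g ys (s≤s k<n) rewrite primRec-outOfFuel k n f g ys k<n = refl

-- primRec with fuel b + n evaluates the base case with fuel b and the j-th step with fuel b + j.
primTrace : Code → Code → List ℕ → ℕ → ℕ → ℕ
primTrace f g ys b zero    = enc (eval b f ys)
primTrace f g ys b (suc j) = cond r (enc (eval (b + j) g (j ∷ pred r ∷ ys)))
  where r = primTrace f g ys b j

enc-primRec : ∀ f g ys b n → enc (primRec (b + n) f g n ys) ≡ primTrace f g ys b n
enc-primRec f g ys b zero    rewrite +-identityʳ b = refl
enc-primRec f g ys b (suc n) rewrite +-suc b n =
  trans (enc-bind (primRec (b + n) f g n ys) (λ r → eval (b + n) g (n ∷ r ∷ ys)))
        (cong (λ z → cond z (enc (eval (b + n) g (n ∷ pred z ∷ ys)))) (enc-primRec f g ys b n))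

enc-primRec-any : ∀ f g k n ys → cond (isZero (n ∸ k)) (primTrace f g ys (k ∸ n) n) ≡ enc (primRec k f g n ys)
enc-primRec-any f g k n ys with n ≤? k
... | yes n≤k rewrite m≤n⇒m∸n≡0 n≤k =
  trans (sym (enc-primRec f g ys (k ∸ n) n)) (cong (λ z → enc (primRec z f g n ys)) (m∸n+n≡m n≤k))
... | no n≰k with n ∸ k | m>n⇒m∸n≢0 (≰⇒> n≰k)
...   | zero  | n∸k≢0 = ⊥-elim (n∸k≢0 refl)
...   | suc _ | _     = sym (cong enc (primRec-outOfFuel k n f g ys (≰⇒> n≰k)))

enc-muStep : ∀ m i r → enc (muStep m i r) ≡ muStepEnc (enc m) i (enc r)
enc-muStep nothing        i r = refl
enc-muStep (just zero)    i r = refl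
enc-muStep (just (suc _)) i r = refl

-- muSearch K f xs 0 tries i with fuel K ∸ suc i; the trace runs these trials from i = K ∸ 1 down to 0.
muTrace : Code → List ℕ → ℕ → ℕ → ℕ
muTrace f xs K zero    = 0
muTrace f xs K (suc j) = muStepEnc (enc (eval j f ((K ∸ suc j) ∷ xs))) (K ∸ suc j) (muTrace f xs K j)

enc-muSearch : ∀ f xs K d → d ≤ K → muTrace f xs K d ≡ enc (muSearch d f xs (K ∸ d))
enc-muSearch f xs K zero    _   = refl
enc-muSearch f xs K (suc d) d<K = begin
  muStepEnc (enc (eval d f (i ∷ xs))) i (muTrace f xs K d)
    ≡⟨ cong (muStepEnc (enc (eval d f (i ∷ xs))) i) (enc-muSearch f xs K d (≤-trans (n≤1+n d) d<K)) ⟩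
  muStepEnc (enc (eval d f (i ∷ xs))) i (enc (muSearch d f xs (K ∸ d)))
    ≡⟨ cong (λ z → muStepEnc (enc (eval d f (i ∷ xs))) i (enc (muSearch d f xs z))) (+-∸-assoc 1 d<K) ⟩
  muStepEnc (enc (eval d f (i ∷ xs))) i (enc (muSearch d f xs (suc i)))
    ≡⟨ enc-muStep (eval d f (i ∷ xs)) i (muSearch d f xs (suc i)) ⟨
  enc (muStep (eval d f (i ∷ xs)) i (muSearch d f xs (suc i)))
    ≡⟨ cong enc (muSearch-unfold d f xs i) ⟨
  enc (muSearch (suc d) f xs i)
    ∎
  where
  open ≡-Reasoning
  i = K ∸ suc d

ClockedCorrect : Code → ℕ → Set
ClockedCorrect c N = ∀ t xs → length xs ≡ N → clocked c N · t ∷ xs ⇓ enc (eval t c xs)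

ClockedLCorrect : List Code → ℕ → Set
ClockedLCorrect gs N = ∀ t xs → length xs ≡ N → clockedL gs N · t ∷ xs ⇓* encs (pred t) gs xs

-- With no fuel every program is out of fuel, encoded as 0; otherwise t ∸ 1 fuel is left for the body.
⇓-clocked : ∀ {X t ys} c xs (w : ℕ → ℕ) → X · t ∷ ys ⇓ w (pred t) →
            (∀ k → w k ≡ enc (eval (suc k) c xs)) → comp₂ COND (proj 0) X · t ∷ ys ⇓ enc (eval t c xs)
⇓-clocked {t = t} c xs w hX w≡ = ⇓-≡ (byFuel t) (⇓-comp₂ (⇓-COND _ _) (⇓-proj 0) hX)
  where
  byFuel : ∀ t → cond t (w (pred t)) ≡ enc (eval t c xs)
  byFuel zero    = refl
  byFuel (suc k) = w≡ k

clocked-zer : ∀ {N} → ClockedCorrect zer N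
clocked-zer t xs _ = ⇓-clocked zer xs (λ _ → 1) (⇓-K 1) (λ _ → refl)

clocked-succ : ∀ {N} → ClockedCorrect succ N
clocked-succ t xs _ = ⇓-clocked succ xs (λ _ → suc (suc (nth0 0 xs)))
  (⇓-comp₁ ⇓-succ (⇓-comp₁ ⇓-succ (⇓-proj 1))) (λ _ → cong (λ z → suc (suc z)) (nth0-zero xs))

clocked-proj : ∀ {N} i → ClockedCorrect (proj i) N
clocked-proj i t xs _ = ⇓-clocked (proj i) xs (λ _ → suc (nth0 i xs))
  (⇓-comp₁ ⇓-succ (⇓-proj (suc i))) (λ _ → refl)

clocked-comp : ∀ {f gs N} → ClockedCorrect f (length gs) → ClockedLCorrect gs N → ClockedCorrect (comp f gs) N
clocked-comp {f} {gs} correct-f correct-gs t xs len =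
  ⇓-clocked (comp f gs) xs body
    (⇓-CONDALL args (⇓-comp (correct-f (pred t) (map pred (encs (pred t) gs xs)) length-args)
                            (⇓-FUEL-1 ∷ map⁺ (comp₁ PRED) pred (Pointwise.map (⇓-comp₁ (⇓-PRED _)) args))))
    (λ k → sym (enc-evalList-bind k gs xs (eval k f)))
  where
  body : ℕ → ℕ
  body k = condAll (encs k gs xs) (enc (eval k f (map pred (encs k gs xs))))
  args = correct-gs t xs len
  length-args : length (map pred (encs (pred t) gs xs)) ≡ length gs
  length-args = trans (length-map pred (encs (pred t) gs xs)) (length-map _ gs)

clockedL-∷ : ∀ {g gs N} → ClockedCorrect g N → ClockedLCorrect gs N → ClockedLCorrect (g ∷ gs) N
clockedL-∷ correct-g correct-gs t xs len =
  ⇓-comp (correct-g (pred t) xs len) (⇓-FUEL-1 ∷ ⇓-drop (t ∷ []) len) ∷ correct-gs t xs len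

clocked-prim : ∀ {f g N} → ClockedCorrect f (pred N) → ClockedCorrect g (suc (suc (pred N))) →
               ClockedCorrect (prim f g) N
clocked-prim {f} {g} {N} correct-f correct-g t xs len =
  ⇓-clocked (prim f g) xs (λ k → cond (isZero (n ∸ k)) (primTrace f g ys (k ∸ n) n))
    (⇓-comp₂ (⇓-COND _ _) (⇓-comp₁ (⇓-ISZERO _) (⇓-comp₂ (⇓-SUB _ _) (⇓-proj 1) ⇓-FUEL-1))
      (⇓-comp (⇓-prim (primTrace f g ys b) (correct-f b ys length-ys) step n)
              (⇓-proj 1 ∷ ⇓-comp₂ (⇓-SUB _ _) ⇓-FUEL-1 (⇓-proj 1) ∷ ⇓-tail t xs len)))
    (λ k → trans (enc-primRec-any f g k n ys) (cong (λ z → enc (primRec k f g z ys)) (nth0-zero xs)))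
  where
  n  = nth0 0 xs
  ys = tail0 xs
  b  = pred t ∸ n
  length-ys : length ys ≡ pred N
  length-ys = length-tail0 xs len
  step : ∀ j → _ · j ∷ primTrace f g ys b j ∷ b ∷ ys ⇓ primTrace f g ys b (suc j)
  step j = ⇓-comp₂ (⇓-COND _ _) (⇓-proj 1)
    (⇓-comp (correct-g (b + j) (j ∷ pred (primTrace f g ys b j) ∷ ys) (cong (λ z → suc (suc z)) length-ys))
      (⇓-comp₂ (⇓-ADD b j) (⇓-proj 2) (⇓-proj 0) ∷ ⇓-proj 0 ∷ ⇓-comp₁ (⇓-PRED _) (⇓-proj 1) ∷
       ⇓-drop (j ∷ _ ∷ b ∷ []) length-ys))

clocked-mu : ∀ {f N} → ClockedCorrect f (suc N) → ClockedCorrect (mu f) N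
clocked-mu {f} {N} correct-f t xs len =
  ⇓-clocked (mu f) xs (λ m → muTrace f xs m m)
    (⇓-comp (⇓-prim (muTrace f xs k) ⇓-zer step k) (⇓-FUEL-1 ∷ ⇓-FUEL-1 ∷ ⇓-drop (t ∷ []) len))
    (λ m → trans (enc-muSearch f xs m m ≤-refl) (cong (λ z → enc (muSearch m f xs z)) (n∸n≡0 m)))
  where
  k = pred t
  step : ∀ j → _ · j ∷ muTrace f xs k j ∷ k ∷ xs ⇓ muTrace f xs k (suc j)
  step j = ⇓-comp₃ (⇓-MUSTEP _ _ _)
    (⇓-comp (correct-f j ((k ∸ suc j) ∷ xs) (cong suc len))
            (⇓-proj 0 ∷ position ∷ ⇓-drop (j ∷ _ ∷ k ∷ []) len))
    position (⇓-proj 1)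
    where
    position = ⇓-comp₂ (⇓-SUB k (suc j)) (⇓-proj 2) (⇓-comp₁ ⇓-succ (⇓-proj 0))

mutual
  clocked-correct : ∀ c N → ClockedCorrect c N
  clocked-correct zer         N = clocked-zer
  clocked-correct succ        N = clocked-succ
  clocked-correct (proj i)    N = clocked-proj i
  clocked-correct (comp f gs) N = clocked-comp (clocked-correct f (length gs)) (clockedL-correct gs N)
  clocked-correct (prim f g)  N = clocked-prim (clocked-correct f (pred N)) (clocked-correct g (suc (suc (pred N))))
  clocked-correct (mu f)      N = clocked-mu (clocked-correct f (suc N))

  clockedL-correct : ∀ gs N → ClockedLCorrect gs N
  clockedL-correct []       N _ _ _ = []
  clockedL-correct (g ∷ gs) N = clockedL-∷ (clocked-correct g N) (clockedL-correct gs N)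

-- The diagonal class

toBool : ℕ → Bool
toBool zero    = false
toBool (suc _) = true

toBool-bit : ∀ b → toBool (bit b) ≡ b
toBool-bit false = refl
toBool-bit true  = refl

bit-toBool : ∀ v → v ≤ 1 → bit (toBool v) ≡ v
bit-toBool zero          _ = refl
bit-toBool (suc zero)    _ = refl
bit-toBool (suc (suc _)) (s≤s ())

cond≤1 : ∀ r p → p ≤ 1 → cond r p ≤ 1
cond≤1 zero    p _   = z≤n
cond≤1 (suc r) p p≤1 = p≤1

isOne-enc : ∀ (m : Maybe ℕ) → m ≢ just 0 → isOne (enc m) ≡ 0
isOne-enc nothing        _  = refl
isOne-enc (just zero)    m≢ = ⊥-elim (m≢ refl)
isOne-enc (just (suc _)) _  = refl

length-prefix : ∀ y k → length (prefix y k) ≡ k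
length-prefix y zero    = refl
length-prefix y (suc k) = trans (length-++ (prefix y k)) (trans (cong (_+ 1) (length-prefix y k)) (+-comm k 1))

module Diagonal (D : Code) where

  answeredZero : ℕ → ℕ → ℕ
  answeredZero x n = isOne (enc (eval n D (x ∷ [])))

  answeredZero-never : ∀ {x} → Halts D (x ∷ []) 1 → ∀ n → answeredZero x n ≡ 0
  answeredZero-never {x} (k , e) n =
    isOne-enc (eval n D (x ∷ [])) (λ e′ → 1≢0 (eval-deterministic {k} {n} {D} e e′))
    where
    1≢0 : 1 ≢ 0
    1≢0 ()

  answeredZero-eventually : ∀ {x} → Halts D (x ∷ []) 0 → ∃ λ t → ∀ d → answeredZero x (t + d) ≡ 1
  answeredZero-eventually {x} (t , e) = t , λ d → cong (λ m → isOne (enc m)) (eval-≤ D (x ∷ []) (m≤m+n t d) e)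

  -- Opaque: otherwise type checking normalises the huge Gödel number ⌜ body ⌝.
  opaque
    body : Code
    body = comp₂ COND (comp₁ ISONE (comp (clocked D 1) (proj 2 ∷ comp₁ SELFAPPLY (proj 0) ∷ [])))
                      (comp TESTBIT (proj 2 ∷ proj 1 ∷ []))

    ⇓-body : ∀ b m n → body · b ∷ m ∷ n ∷ [] ⇓ cond (answeredZero (selfApplyCode b) n) (testBit n m)
    ⇓-body b m n = ⇓-comp₂ (⇓-COND _ _)
      (⇓-comp₁ (⇓-ISONE _) (⇓-comp (clocked-correct D 1 n (selfApplyCode b ∷ []) refl)
                                   (⇓-proj 2 ∷ ⇓-comp₁ (⇓-SELFAPPLY b) (⇓-proj 0) ∷ [])))
      (⇓-comp (⇓-TESTBIT n m) (⇓-proj 2 ∷ ⇓-proj 1 ∷ []))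

  classCode : Code
  classCode = selfApply body

  member : ℕ → ℕ → ℕ
  member m n = cond (answeredZero ⌜ classCode ⌝ n) (testBit n m)

  G : ℕ → ℕ → Bool
  G m n = toBool (member m n)

  classCode-computes : Computes₂ classCode (λ m n → bit (G m n))
  classCode-computes m n = ⇓⇒Halts (⇓-≡ (sym (bit-toBool (member m n) member≤1))
    (⇓-comp (⇓-body ⌜ body ⌝ m n) (⇓-K ⌜ body ⌝ ∷ ⇓-proj 0 ∷ ⇓-proj 1 ∷ [])))
    where
    member≤1 = cond≤1 (answeredZero ⌜ classCode ⌝ n) _ (parity≤1 (shiftR n m))

  no-tree : Halts D (⌜ classCode ⌝ ∷ []) 1 → ¬ HasInfiniteLittlestoneTree G
  no-tree halts₁ (x , tree) with tree (λ _ → true) 0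
  ... | m , realises with realises 0 z≤n
  ... | G≡true rewrite answeredZero-never halts₁ (x []) with G≡true
  ...   | ()

  tree : Halts D (⌜ classCode ⌝ ∷ []) 0 → HasInfiniteLittlestoneTree G
  tree halts₀ with answeredZero-eventually halts₀
  ... | t , answered = (λ v → t + length v) , shattered
    where
    shattered : IsInfiniteLittlestoneTree G (λ v → t + length v)
    shattered y N = m , realises
      where
      m = fromBits (λ i → y (i ∸ t)) (t + suc N)
      realises : ∀ k → k ≤ N → G m (t + length (prefix y k)) ≡ y k
      realises k k≤N = begin
        G m (t + length (prefix y k))
          ≡⟨ cong (λ z → G m (t + z)) (length-prefix y k) ⟩
        toBool (cond (answeredZero _ (t + k)) (testBit (t + k) m))
          ≡⟨ cong (λ z → toBool (cond z (testBit (t + k) m))) (answered k) ⟩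
        toBool (testBit (t + k) m)
          ≡⟨ cong toBool (testBit-fromBits _ (t + suc N) (t + k) (+-monoʳ-< t (s≤s k≤N))) ⟩
        toBool (bit (y (t + k ∸ t)))
          ≡⟨ toBool-bit _ ⟩
        y (t + k ∸ t)
          ≡⟨ cong y (m+n∸m≡n t k) ⟩
        y k
          ∎
        where open ≡-Reasoning

corollary4p12 : ¬ Σ Code DecidesInfiniteLittlestone
corollary4p12 (D , decides) = no-tree (saysYes hasTree) hasTree
  where
  open Diagonal D
  saysYes = proj₁ (decides classCode G classCode-computes)
  saysNo  = proj₂ (decides classCode G classCode-computes)
  hasTree = tree (saysNo (λ t → no-tree (saysYes t) t))
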